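{- In $\mathrm{Free}(\mathcal E)$, in an untwisted simple 1-morphism, every wire is either straight or contains an eliminable $(\cup,\cap)$ pair.
   Context: $\mathcal E$ is the extended Frobenius presentation with object $C$ and generating 1-morphisms $m: C\boxtimes C\to C$, $u:1\to C$, $\cup: 1\to C\boxtimes C$, $f: C\to 1$, $\cap: C\boxtimes C\to 1$ (plus 2-morphisms); $\mathrm{Free}(\mathcal E)$ is the free monoidal bicategory it generates; string diagrams are read bottom to top. A 1-morphism is simple if its string diagram graph is connected and acyclic and it has a unique output wire. For an $m$, $u$ or $f$ vertex $v$, $\mathrm{Tw}(v)$ is the number of right turns minus left turns along the shortest path from $v$ to the unique output wire (turns occur at cups and caps, and when passing through an $m$ vertex from one input leg to the other); untwisted means $\mathrm{Tw}(v)=0$ for all such $v$. A wire (path between $m$/$u$ vertices) is straight if it passes through no cups or caps. A chosen $(\cup,\cap)$ pair is eliminable if the cup and cap are directly connected by a single wire segment and turn in opposite directions (forming a zigzag, in either orientation); other parts of the diagram may lie between them in height. -}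

module Defs where

open import Data.Nat using (ℕ; zero; suc; _+_; _≤_; _<_)
open import Data.Integer using (ℤ; 0ℤ; 1ℤ; -1ℤ; -_) renaming (_+_ to _+ℤ_)
open import Data.List using (List; []; _∷_; _++_; map; upTo; take; drop; zip; zipWith; length; foldr; [_])
open import Data.List.Relation.Unary.All using (All)
open import Data.List.Relation.Unary.Any using (Any)
open import Data.List.Relation.Unary.Unique.Propositional using (Unique)
open import Data.List.Membership.Propositional using (_∈_)
open import Data.Maybe using (Maybe; just; nothing)
open import Data.Product using (Σ; ∃; ∃-syntax; _×_; _,_; proj₁; proj₂)
open import Data.Sum using (_⊎_)
open import Relation.Binary.PropositionalEquality using (_≡_; _≢_)
open import Relation.Nullary using (¬_)

-- The object C⊠…⊠C (n copies) is represented by n; the unit 1 by 0.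
--   m : C⊠C → C,  u : 1 → C,  cup : 1 → C⊠C,  f : C → 1,  cap : C⊠C → 1

data Gen : Set where
  m u cup f cap : Gen

arIn : Gen → ℕ
arIn m   = 2
arIn u   = 0
arIn cup = 0
arIn f   = 1
arIn cap = 2

arOut : Gen → ℕ
arOut m   = 1
arOut u   = 1
arOut cup = 2
arOut f   = 0
arOut cap = 0

-- 1-morphisms of Free(E), presented by their string diagrams in layered
-- form (read bottom to top): a composite of whiskered generators
-- id_k ⊠ g ⊠ id_l.  Every 1-morphism of the free monoidal bicategory is
-- (up to the structural coherence cells, which have identity string
-- diagrams) such a composite.

data Diagram (n : ℕ) : ℕ → Set where
  idD   : Diagram n n
  layer : (i : ℕ) (g : Gen) (l : ℕ) →
          Diagram n (i + arIn g + l) → Diagram n (i + arOut g + l)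

-- generators of the layers, bottom to top (layer index c = position)
gens : ∀ {n k} → Diagram n k → List Gen
gens idD             = []
gens (layer k g l D) = gens D ++ [ g ]

data Vtx : Set where
  inp  : ℕ → Vtx
  outp : ℕ → Vtx
  node : ℕ → Vtx

-- lo = an input leg (attached below the vertex), hi = an output leg
data Side : Set where
  lo hi : Side

record Port : Set where
  constructor port
  field
    vtx  : Vtx
    side : Side
    leg  : ℕ
open Port public

-- tracing wires bottom to top: the port each current wire comes from,
-- the edges found so far, and the number of layers so far
traceD : ∀ {n k} → Diagram n k → List Port × List (Port × Port) × ℕ
traceD {n} idD = map (λ i → port (inp i) hi 0) (upTo n) , [] , 0
traceD (layer k g l D) with traceD D
... | st , es , c =
  take k st ++ map (λ b → port (node c) hi b) (upTo (arOut g)) ++ drop (k + arIn g) st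
  , es ++ zipWith (λ p a → (p , port (node c) lo a)) (take (arIn g) (drop k st)) (upTo (arIn g))
  , suc c

-- edges (wire segments) as (lower port , upper port)
edges : ∀ {n k} → Diagram n k → List (Port × Port)
edges {k = k} D with traceD D
... | st , es , _ = es ++ zipWith (λ p j → (p , port (outp j) lo 0)) st (upTo k)

vertices : ∀ {n k} → Diagram n k → List Vtx
vertices {n} {k} D = map inp (upTo n) ++ map outp (upTo k) ++ map node (upTo (length (gens D)))

kindAt : List Gen → ℕ → Maybe Gen
kindAt []       _       = nothing
kindAt (g ∷ gs) zero    = just g
kindAt (g ∷ gs) (suc c) = kindAt gs c

vkind : ∀ {n k} → Diagram n k → Vtx → Maybe Gen
vkind D (node c) = kindAt (gens D) c
vkind D _        = nothing

-- Paths: a path is a nonempty list of oriented edges (a , b) (travel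
-- from port a along a wire segment to port b); consecutive edges meet
-- at the same vertex and leave it by a different leg.

Step : ∀ {n k} → Diagram n k → Port × Port → Set
Step D (a , b) = (a , b) ∈ edges D ⊎ (b , a) ∈ edges D

-- junctions (entering port , leaving port) at the intermediate vertices
junctions : List (Port × Port) → List (Port × Port)
junctions []                         = []
junctions (_ ∷ [])                   = []
junctions ((a , b) ∷ (c , d) ∷ rest) = (b , c) ∷ junctions ((c , d) ∷ rest)

GoodJunction : Port × Port → Set
GoodJunction (b , c) = vtx b ≡ vtx c × b ≢ c

firstPort : List (Port × Port) → Maybe Port
firstPort []            = nothing
firstPort ((a , _) ∷ _) = just a

lastPort : List (Port × Port) → Maybe Port
lastPort []             = nothing
lastPort ((_ , b) ∷ []) = just b
lastPort (_ ∷ e ∷ es)   = lastPort (e ∷ es)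

mvtx : Maybe Port → Maybe Vtx
mvtx (just p) = just (vtx p)
mvtx nothing  = nothing

IsPath : ∀ {n k} → Diagram n k → Vtx → Vtx → List (Port × Port) → Set
IsPath D v w ps =
  All (Step D) ps × All GoodJunction (junctions ps) ×
  mvtx (firstPort ps) ≡ just v × mvtx (lastPort ps) ≡ just w

interior : List (Port × Port) → List Vtx
interior ps = map (λ j → vtx (proj₁ j)) (junctions ps)

IsCycle : ∀ {n k} → Diagram n k → List (Port × Port) → Set
IsCycle D ps = Σ Vtx λ v → IsPath D v v ps × Unique (v ∷ interior ps) ×
  firstPort ps ≢ lastPort ps

Connected : ∀ {n k} → Diagram n k → Set
Connected D = ∀ v w → v ∈ vertices D → w ∈ vertices D →
  v ≡ w ⊎ ∃[ ps ] IsPath D v w ps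

Acyclic : ∀ {n k} → Diagram n k → Set
Acyclic D = ¬ (∃[ ps ] IsCycle D ps)

Simple : ∀ {n k} → Diagram n k → Set
Simple {k = k} D = Connected D × Acyclic D × k ≡ 1

-- Turns.  +1 = right turn, -1 = left turn (reading the diagram in the
-- plane, bottom to top, legs numbered left to right).
--   cap  : entering left leg, leaving right leg  = right turn
--   cup  : entering left leg, leaving right leg  = left turn
--   m    : input leg to the other input leg, like a cap
--   m    : between an input and the output leg  = no turn

turn : Maybe Gen → Port → Port → ℤ
turn (just cap) (port _ lo 0) (port _ lo 1) = 1ℤ
turn (just cap) (port _ lo 1) (port _ lo 0) = -1ℤ
turn (just m)   (port _ lo 0) (port _ lo 1) = 1ℤ
turn (just m)   (port _ lo 1) (port _ lo 0) = -1ℤ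
turn (just cup) (port _ hi 0) (port _ hi 1) = -1ℤ
turn (just cup) (port _ hi 1) (port _ hi 0) = 1ℤ
turn _          _             _             = 0ℤ

turnAt : ∀ {n k} → Diagram n k → Port × Port → ℤ
turnAt D (b , c) = turn (vkind D (vtx b)) b c

twist : ∀ {n k} → Diagram n k → List (Port × Port) → ℤ
twist D ps = foldr (λ j z → turnAt D j +ℤ z) 0ℤ (junctions ps)

ShortestPath : ∀ {n k} → Diagram n k → Vtx → Vtx → List (Port × Port) → Set
ShortestPath D v w ps = IsPath D v w ps ×
  (∀ qs → IsPath D v w qs → length ps ≤ length qs)

Untwisted : ∀ {n k} → Diagram n k → Set
Untwisted {k = k} D = ∀ c g → vkind D (node c) ≡ just g →
  (g ≡ Gen.m ⊎ g ≡ u ⊎ g ≡ f) →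
  ∀ j → j < k → ∀ ps → ShortestPath D (node c) (outp j) ps → twist D ps ≡ 0ℤ

IsMU : ∀ {n k} → Diagram n k → Vtx → Set
IsMU D v = vkind D v ≡ just Gen.m ⊎ vkind D v ≡ just u

IsCupCap : ∀ {n k} → Diagram n k → Vtx → Set
IsCupCap D v = vkind D v ≡ just cup ⊎ vkind D v ≡ just cap

IsWire : ∀ {n k} → Diagram n k → Vtx → Vtx → List (Port × Port) → Set
IsWire D v w ps = IsPath D v w ps × IsMU D v × IsMU D w ×
  All (IsCupCap D) (interior ps)

Straight : ∀ {n k} → Diagram n k → List (Port × Port) → Set
Straight D ps = All (λ x → ¬ IsCupCap D x) (interior ps)

consecutive : ∀ {A : Set} → List A → List (A × A)
consecutive []           = []
consecutive (x ∷ [])     = []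
consecutive (x ∷ y ∷ xs) = (x , y) ∷ consecutive (y ∷ xs)

-- a cup and a cap met consecutively along the path (so joined directly
-- by a single wire segment of it) that turn in opposite directions
EliminablePair : ∀ {n k} → Diagram n k → (Port × Port) × (Port × Port) → Set
EliminablePair D (j₁ , j₂) =
  ((vkind D (vtx (proj₁ j₁)) ≡ just cup × vkind D (vtx (proj₁ j₂)) ≡ just cap) ⊎
   (vkind D (vtx (proj₁ j₁)) ≡ just cap × vkind D (vtx (proj₁ j₂)) ≡ just cup)) ×
  turnAt D j₁ ≢ 0ℤ × turnAt D j₁ ≡ - turnAt D j₂

HasEliminablePair : ∀ {n k} → Diagram n k → List (Port × Port) → Set
HasEliminablePair D ps = Any (EliminablePair D) (consecutive (junctions ps))

-- A simple diagram is a tree, so two vertices are joined by exactly one non-backtracking path.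
-- The inner vertices of a wire W from v to w are cups and caps, which alternate along W; if no
-- cup and cap next to each other turn in opposite directions, all turns of W have the same
-- sign and Tw(W) ≠ 0.  The paths S_v and S_w from v and w to the output are untwisted, and a
-- parity count shows that they leave v and w by their output legs.  If W enters w from below,
-- then W followed by S_w is the path from v to the output, that is S_v, so Tw(W) = Tw(S_v) = 0;
-- symmetrically if W leaves v from below.  Otherwise S_v starts along W, since cups and caps do
-- not branch, and then leaves w by a leg other than its output leg: a second path from w to the
-- output besides S_w.

module Submission where

open import Defs

open import Data.Bool using (Bool; true; false; not)
open import Data.Bool.Properties using (not-involutive)
open import Data.Empty using (⊥; ⊥-elim)
open import Data.Integer using (ℤ; 0ℤ; 1ℤ; -1ℤ; -_) renaming (_+_ to _+ℤ_)
import Data.Integer as ℤ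
import Data.Integer.Properties as ℤₚ
open import Data.List using (List; []; _∷_; _++_; _∷ʳ_; initLast; _∷ʳ′_; map; upTo; take; drop; zipWith; length; reverse; foldr; [_])
open import Data.List.Membership.Propositional using (_∈_)
open import Data.List.Membership.Propositional.Properties using (∈-map⁺; ∈-map⁻; ∈-∃++; ∈-++⁺ˡ; ∈-++⁺ʳ; ∈-upTo⁺)
open import Data.List.Properties using (++-identityʳ; length-++; length-map; length-upTo; take++drop≡id; drop-drop; map-++; ++-assoc; unfold-reverse; reverse-map; reverse-involutive; length-reverse; map-∘; map-id)
open import Data.List.Relation.Binary.Disjoint.Propositional using (Disjoint)
open import Data.List.Relation.Binary.Permutation.Propositional using (_↭_; ↭-sym; ↭⇒↭ₛ; module PermutationReasoning)
import Data.List.Relation.Binary.Permutation.Propositional.Properties as ↭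
import Data.List.Relation.Binary.Permutation.Setoid.Properties as ↭ₛ
open import Data.List.Relation.Unary.All as All using (All; []; _∷_)
import Data.List.Relation.Unary.All.Properties as All
open import Data.List.Relation.Unary.All.Properties using (¬Any⇒All¬)
open import Data.List.Relation.Unary.AllPairs using ([]; _∷_)
open import Data.List.Relation.Unary.Any using (here; there)
open import Data.List.Relation.Unary.Unique.Propositional using (Unique)
import Data.List.Relation.Unary.Unique.Propositional.Properties as Unique
open import Data.Maybe using (just)
import Data.Maybe.Properties as Maybe
open Maybe using (just-injective)
open import Data.Nat using (ℕ; zero; suc; _+_; _<_; s≤s; z≤n)
import Data.Nat as ℕ
open import Data.Nat.Induction using (<-wellFounded)
open import Data.Nat.Properties using (<-irrefl; +-assoc; +-comm; suc-injective; m<n⇒m<1+n; ≤-refl; <-≤-trans; ≤-reflexive)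
open import Data.Product using (∃; ∃-syntax; _×_; _,_; proj₁; proj₂; swap)
open import Data.Sum as Sum using (_⊎_; inj₁; inj₂)
open import Function using (_∘_)
open import Induction.WellFounded using (Acc; acc)
open import Relation.Binary.Definitions using (DecidableEquality)
open import Relation.Binary.PropositionalEquality using (_≡_; _≢_; refl; sym; trans; cong; cong₂; subst; setoid; module ≡-Reasoning)
open import Relation.Nullary using (¬_; yes; no; _×-dec_)
import Relation.Nullary.Decidable as Dec

hi≢lo : hi ≢ lo
hi≢lo ()

flipSide : Side → Side
flipSide lo = hi
flipSide hi = lo

flipSide-≢ : ∀ s → s ≢ flipSide s
flipSide-≢ lo ()
flipSide-≢ hi ()

sameSide : Side → Side → Bool
sameSide lo lo = true
sameSide hi hi = true
sameSide lo hi = false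
sameSide hi lo = false

sameSide-flip : ∀ s s′ → not (sameSide (flipSide s) s′) ≡ sameSide s s′
sameSide-flip lo lo = refl
sameSide-flip lo hi = refl
sameSide-flip hi lo = refl
sameSide-flip hi hi = refl

sameSide-flipSide : ∀ s → sameSide s (flipSide s) ≡ false
sameSide-flipSide lo = refl
sameSide-flipSide hi = refl

≢-flipSide : ∀ {s s′} → s ≢ flipSide s′ → s ≡ s′
≢-flipSide {lo} {lo} _ = refl
≢-flipSide {hi} {hi} _ = refl
≢-flipSide {lo} {hi} ≢ = ⊥-elim (≢ refl)
≢-flipSide {hi} {lo} ≢ = ⊥-elim (≢ refl)

IsSign : ℤ → Set
IsSign t = t ≡ 1ℤ ⊎ t ≡ -1ℤ

-- the turn t of a path passing from a leg on side s to a leg on side s′ of the same vertex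
Turning : Side → Side → ℤ → Set
Turning s s′ t = (s ≡ s′ × IsSign t) ⊎ (s ≢ s′ × t ≡ 0ℤ)

data Leg : Gen → Side → ℕ → Set where
  m-in₀    : Leg m lo 0
  m-in₁    : Leg m lo 1
  m-out    : Leg m hi 0
  u-out    : Leg u hi 0
  cup-out₀ : Leg cup hi 0
  cup-out₁ : Leg cup hi 1
  f-in     : Leg f lo 0
  cap-in₀  : Leg cap lo 0
  cap-in₁  : Leg cap lo 1

leg-out : ∀ g {b} → b < arOut g → Leg g hi b
leg-out m   {0}           _                = m-out
leg-out m   {suc _}       (s≤s ())
leg-out u   {0}           _                = u-out
leg-out u   {suc _}       (s≤s ())
leg-out cup {0}           _                = cup-out₀
leg-out cup {1}           _                = cup-out₁
leg-out cup {suc (suc _)} (s≤s (s≤s ()))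
leg-out f   ()
leg-out cap ()

leg-in : ∀ g {a} → a < arIn g → Leg g lo a
leg-in m   {0}           _                = m-in₀
leg-in m   {1}           _                = m-in₁
leg-in m   {suc (suc _)} (s≤s (s≤s ()))
leg-in u   ()
leg-in cup ()
leg-in f   {0}           _                = f-in
leg-in f   {suc _}       (s≤s ())
leg-in cap {0}           _                = cap-in₀
leg-in cap {1}           _                = cap-in₁
leg-in cap {suc (suc _)} (s≤s (s≤s ()))

two-legged : ∀ {g s₁ l₁ s₂ l₂ s₃ l₃} → g ≡ cup ⊎ g ≡ cap → Leg g s₁ l₁ → Leg g s₂ l₂ → Leg g s₃ l₃ →
             (s₁ , l₁) ≢ (s₂ , l₂) → (s₁ , l₁) ≢ (s₃ , l₃) → (s₂ , l₂) ≡ (s₃ , l₃)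
two-legged (inj₁ refl) cup-out₀ cup-out₀ _        ≢₂ _  = ⊥-elim (≢₂ refl)
two-legged (inj₁ refl) cup-out₀ cup-out₁ cup-out₀ _  ≢₃ = ⊥-elim (≢₃ refl)
two-legged (inj₁ refl) cup-out₀ cup-out₁ cup-out₁ _  _  = refl
two-legged (inj₁ refl) cup-out₁ cup-out₁ _        ≢₂ _  = ⊥-elim (≢₂ refl)
two-legged (inj₁ refl) cup-out₁ cup-out₀ cup-out₁ _  ≢₃ = ⊥-elim (≢₃ refl)
two-legged (inj₁ refl) cup-out₁ cup-out₀ cup-out₀ _  _  = refl
two-legged (inj₂ refl) cap-in₀  cap-in₀  _        ≢₂ _  = ⊥-elim (≢₂ refl)
two-legged (inj₂ refl) cap-in₀  cap-in₁  cap-in₀  _  ≢₃ = ⊥-elim (≢₃ refl)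
two-legged (inj₂ refl) cap-in₀  cap-in₁  cap-in₁  _  _  = refl
two-legged (inj₂ refl) cap-in₁  cap-in₁  _        ≢₂ _  = ⊥-elim (≢₂ refl)
two-legged (inj₂ refl) cap-in₁  cap-in₀  cap-in₁  _  ≢₃ = ⊥-elim (≢₃ refl)
two-legged (inj₂ refl) cap-in₁  cap-in₀  cap-in₀  _  _  = refl

leg-turning : ∀ {g s l s′ l′} v w → Leg g s l → Leg g s′ l′ → (s ≡ s′ → l ≢ l′) →
              Turning s s′ (turn (just g) (port v s l) (port w s′ l′))
leg-turning v w m-in₀    m-in₀    ≢ = ⊥-elim (≢ refl refl)
leg-turning v w m-in₀    m-in₁    ≢ = inj₁ (refl , inj₁ refl)
leg-turning v w m-in₀    m-out    ≢ = inj₂ ((λ ()) , refl)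
leg-turning v w m-in₁    m-in₀    ≢ = inj₁ (refl , inj₂ refl)
leg-turning v w m-in₁    m-in₁    ≢ = ⊥-elim (≢ refl refl)
leg-turning v w m-in₁    m-out    ≢ = inj₂ ((λ ()) , refl)
leg-turning v w m-out    m-in₀    ≢ = inj₂ ((λ ()) , refl)
leg-turning v w m-out    m-in₁    ≢ = inj₂ ((λ ()) , refl)
leg-turning v w m-out    m-out    ≢ = ⊥-elim (≢ refl refl)
leg-turning v w u-out    u-out    ≢ = ⊥-elim (≢ refl refl)
leg-turning v w cup-out₀ cup-out₀ ≢ = ⊥-elim (≢ refl refl)
leg-turning v w cup-out₀ cup-out₁ ≢ = inj₁ (refl , inj₂ refl)
leg-turning v w cup-out₁ cup-out₀ ≢ = inj₁ (refl , inj₁ refl)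
leg-turning v w cup-out₁ cup-out₁ ≢ = ⊥-elim (≢ refl refl)
leg-turning v w f-in     f-in     ≢ = ⊥-elim (≢ refl refl)
leg-turning v w cap-in₀  cap-in₀  ≢ = ⊥-elim (≢ refl refl)
leg-turning v w cap-in₀  cap-in₁  ≢ = inj₁ (refl , inj₁ refl)
leg-turning v w cap-in₁  cap-in₀  ≢ = inj₁ (refl , inj₂ refl)
leg-turning v w cap-in₁  cap-in₁  ≢ = ⊥-elim (≢ refl refl)

leg-turn-antisym : ∀ {g s l s′ l′} v w → Leg g s l → Leg g s′ l′ →
                   turn (just g) (port w s′ l′) (port v s l) ≡ - turn (just g) (port v s l) (port w s′ l′)
leg-turn-antisym v w m-in₀    m-in₀    = refl
leg-turn-antisym v w m-in₀    m-in₁    = refl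
leg-turn-antisym v w m-in₀    m-out    = refl
leg-turn-antisym v w m-in₁    m-in₀    = refl
leg-turn-antisym v w m-in₁    m-in₁    = refl
leg-turn-antisym v w m-in₁    m-out    = refl
leg-turn-antisym v w m-out    m-in₀    = refl
leg-turn-antisym v w m-out    m-in₁    = refl
leg-turn-antisym v w m-out    m-out    = refl
leg-turn-antisym v w u-out    u-out    = refl
leg-turn-antisym v w cup-out₀ cup-out₀ = refl
leg-turn-antisym v w cup-out₀ cup-out₁ = refl
leg-turn-antisym v w cup-out₁ cup-out₀ = refl
leg-turn-antisym v w cup-out₁ cup-out₁ = refl
leg-turn-antisym v w f-in     f-in     = refl
leg-turn-antisym v w cap-in₀  cap-in₀  = refl
leg-turn-antisym v w cap-in₀  cap-in₁  = refl
leg-turn-antisym v w cap-in₁  cap-in₀  = refl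
leg-turn-antisym v w cap-in₁  cap-in₁  = refl

module _ {A B C : Set} (F : B → C) where

  map-proj₁-zipWith : ∀ (xs : List A) ys → length xs ≡ length ys →
                      map proj₁ (zipWith (λ x y → x , F y) xs ys) ≡ xs
  map-proj₁-zipWith []       []       _ = refl
  map-proj₁-zipWith (x ∷ xs) (y ∷ ys) e = cong (x ∷_) (map-proj₁-zipWith xs ys (suc-injective e))

  map-proj₂-zipWith : ∀ (xs : List A) ys → length xs ≡ length ys →
                      map proj₂ (zipWith (λ x y → x , F y) xs ys) ≡ map F ys
  map-proj₂-zipWith []       []       _ = refl
  map-proj₂-zipWith (x ∷ xs) (y ∷ ys) e = cong (F y ∷_) (map-proj₂-zipWith xs ys (suc-injective e))

  All-zipWith : ∀ {P : A → Set} {Q : C → Set} {xs : List A} {ys} → All P xs → All (λ y → Q (F y)) ys →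
                All (λ e → P (proj₁ e) × Q (proj₂ e)) (zipWith (λ x y → x , F y) xs ys)
  All-zipWith []         _          = []
  All-zipWith (_ ∷ _)    []         = []
  All-zipWith (px ∷ pxs) (qy ∷ qys) = (px , qy) ∷ All-zipWith pxs qys

module _ {A : Set} where

  length-take-+ : ∀ n {j} (xs : List A) → length xs ≡ n + j → length (take n xs) ≡ n
  length-take-+ zero    xs       e = refl
  length-take-+ (suc n) (x ∷ xs) e = cong suc (length-take-+ n xs (suc-injective e))

  length-drop-+ : ∀ n {j} (xs : List A) → length xs ≡ n + j → length (drop n xs) ≡ j
  length-drop-+ zero    xs       e = e
  length-drop-+ (suc n) (x ∷ xs) e = length-drop-+ n xs (suc-injective e)

  length-<-++ : ∀ (xs : List A) y ys → length xs < length (xs ++ y ∷ ys)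
  length-<-++ []       y ys = s≤s z≤n
  length-<-++ (x ∷ xs) y ys = s≤s (length-<-++ xs y ys)

  take-drop-split : ∀ k a (xs : List A) → xs ≡ take k xs ++ take a (drop k xs) ++ drop (k + a) xs
  take-drop-split k a xs = begin
    xs                                                    ≡⟨ take++drop≡id k xs ⟨
    take k xs ++ drop k xs                                ≡⟨ cong (take k xs ++_) (take++drop≡id a (drop k xs)) ⟨
    take k xs ++ take a (drop k xs) ++ drop a (drop k xs) ≡⟨ cong (λ ys → take k xs ++ take a (drop k xs) ++ ys) (drop-drop k a xs) ⟩
    take k xs ++ take a (drop k xs) ++ drop (k + a) xs    ∎
    where open ≡-Reasoning

  length-splice : ∀ k a {l} (xs ys : List A) → length xs ≡ k + a + l →
                  length (take k xs ++ ys ++ drop (k + a) xs) ≡ k + length ys + l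
  length-splice k a {l} xs ys |xs| = begin
    length (take k xs ++ ys ++ drop (k + a) xs)             ≡⟨ length-++ (take k xs) ⟩
    length (take k xs) + length (ys ++ drop (k + a) xs)     ≡⟨ cong (length (take k xs) +_) (length-++ ys) ⟩
    length (take k xs) + (length ys + length (drop (k + a) xs)) ≡⟨ cong₂ (λ x y → x + (length ys + y))
                                                                     (length-take-+ k xs (trans |xs| (+-assoc k a l)))
                                                                     (length-drop-+ (k + a) xs |xs|) ⟩
    k + (length ys + l)                                     ≡⟨ +-assoc k (length ys) l ⟨
    k + length ys + l                                       ∎
    where open ≡-Reasoning

  regroup : ∀ (N E T X B : List A) → N ++ E ++ T ++ X ++ B ↭ (E ++ X) ++ T ++ N ++ B
  regroup N E T X B = begin
    N ++ E ++ T ++ X ++ B   ↭⟨ ↭.shifts N E ⟩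
    E ++ N ++ T ++ X ++ B   ↭⟨ ↭.++⁺ˡ E (↭.shifts N T) ⟩
    E ++ T ++ N ++ X ++ B   ↭⟨ ↭.++⁺ˡ E (↭.++⁺ˡ T (↭.shifts N X)) ⟩
    E ++ T ++ X ++ N ++ B   ↭⟨ ↭.++⁺ˡ E (↭.shifts T X) ⟩
    E ++ X ++ T ++ N ++ B   ≡⟨ ++-assoc E X (T ++ N ++ B) ⟨
    (E ++ X) ++ T ++ N ++ B ∎
    where open PermutationReasoning

  Unique-splice : ∀ k a (E xs N : List A) → Unique (E ++ xs) → Unique N → Disjoint N (E ++ xs) →
                  Unique ((E ++ take a (drop k xs)) ++ take k xs ++ N ++ drop (k + a) xs)
  Unique-splice k a E xs N unique-old unique-new fresh =
    ↭ₛ.Unique-resp-↭ (setoid A) (↭⇒↭ₛ (regroup N E (take k xs) (take a (drop k xs)) (drop (k + a) xs)))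
      (subst (λ ys → Unique (N ++ E ++ ys)) (take-drop-split k a xs) (Unique.++⁺ unique-new unique-old fresh))

disjoint : ∀ {A : Set} {P Q : A → Set} {xs ys : List A} → All P xs → All Q ys → (∀ {p} → P p → Q p → ⊥) → Disjoint xs ys
disjoint pxs qys ¬pq (p∈xs , p∈ys) = ¬pq (All.lookup pxs p∈xs) (All.lookup qys p∈ys)

Unique-map-injective : ∀ {A B : Set} (h : A → B) {xs : List A} → Unique (map h xs) →
                       ∀ {x y} → x ∈ xs → y ∈ xs → h x ≡ h y → x ≡ y
Unique-map-injective h (_ ∷ _)      (here refl) (here refl) _ = refl
Unique-map-injective h (h∉ ∷ _)     (here refl) (there y∈)  e = ⊥-elim (All.lookup h∉ (∈-map⁺ h y∈) e)
Unique-map-injective h (h∉ ∷ _)     (there x∈)  (here refl) e = ⊥-elim (All.lookup h∉ (∈-map⁺ h x∈) (sym e))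
Unique-map-injective h (_ ∷ unique) (there x∈)  (there y∈)  e = Unique-map-injective h unique x∈ y∈ e

ValidPort : List Gen → Port → Set
ValidPort gs (port (inp _)  s l) = s ≡ hi × l ≡ 0
ValidPort gs (port (outp _) s l) = s ≡ lo × l ≡ 0
ValidPort gs (port (node c) s l) = ∃[ g ] kindAt gs c ≡ just g × Leg g s l

kindAt-++ : ∀ xs ys c {g} → kindAt xs c ≡ just g → kindAt (xs ++ ys) c ≡ just g
kindAt-++ (x ∷ xs) ys zero    e = e
kindAt-++ (x ∷ xs) ys (suc c) e = kindAt-++ xs ys c e

kindAt-snoc : ∀ xs g → kindAt (xs ++ [ g ]) (length xs) ≡ just g
kindAt-snoc []       g = refl
kindAt-snoc (x ∷ xs) g = kindAt-snoc xs g

kindAt-< : ∀ xs c {g} → kindAt xs c ≡ just g → c < length xs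
kindAt-< (x ∷ xs) zero    e = s≤s z≤n
kindAt-< (x ∷ xs) (suc c) e = s≤s (kindAt-< xs c e)

ValidPort-++ : ∀ gs ys p → ValidPort gs p → ValidPort (gs ++ ys) p
ValidPort-++ gs ys (port (inp _)  _ _) v = v
ValidPort-++ gs ys (port (outp _) _ _) v = v
ValidPort-++ gs ys (port (node c) _ _) (g , e , leg) = g , kindAt-++ gs ys c e , leg

ValidPort-fresh : ∀ gs p → ValidPort gs p → vtx p ≢ node (length gs)
ValidPort-fresh gs (port (node c) _ _) (g , e , _) refl = <-irrefl refl (kindAt-< gs c e)

port-≡ : ∀ {p q} → vtx p ≡ vtx q → (side p , leg p) ≡ (side q , leg q) → p ≡ q
port-≡ refl refl = refl

port-injective : ∀ {v s l l′} → port v s l ≡ port v s l′ → l ≡ l′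
port-injective refl = refl

Source : List Gen → Port → Set
Source gs p = ValidPort gs p × side p ≡ hi

Target : List Gen → Port → Set
Target gs p = ValidPort gs p × side p ≡ lo

data IsNode : Vtx → Set where
  isNode : ∀ c → IsNode (node c)

InnerEdge : List Gen → Port × Port → Set
InnerEdge gs (a , b) = Source gs a × Target gs b × IsNode (vtx b)

record StateInvariant (gs : List Gen) (k : ℕ) (st : List Port) (es : List (Port × Port)) (c : ℕ) : Set where
  constructor stateInvariant
  field
    layers      : c ≡ length gs
    width       : length st ≡ k
    sources     : All (Source gs) st
    innerEdges  : All (InnerEdge gs) es
    uniqueLower : Unique (map proj₁ es ++ st)
    uniqueUpper : Unique (map proj₂ es)

TraceInvariant : List Gen → ℕ → List Port × List (Port × Port) × ℕ → Set
TraceInvariant gs k (st , es , c) = StateInvariant gs k st es c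

traceStep : ℕ → Gen → List Port × List (Port × Port) × ℕ → List Port × List (Port × Port) × ℕ
traceStep k g (st , es , c) =
  take k st ++ map (λ b → port (node c) hi b) (upTo (arOut g)) ++ drop (k + arIn g) st
  , es ++ zipWith (λ p a → (p , port (node c) lo a)) (take (arIn g) (drop k st)) (upTo (arIn g))
  , suc c

traceD-layer : ∀ {n} k g l (D : Diagram n (k + arIn g + l)) → traceD (layer k g l D) ≡ traceStep k g (traceD D)
traceD-layer k g l D with traceD D
... | _ = refl

new-ports-unique : ∀ x s n → Unique (map (port x s) (upTo n))
new-ports-unique x s n = Unique.map⁺ port-injective (Unique.upTo⁺ n)

traceStep-invariant : ∀ gs k g l t → TraceInvariant gs (k + arIn g + l) t →
                      TraceInvariant (gs ++ [ g ]) (k + arOut g + l) (traceStep k g t)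
traceStep-invariant gs k g l (st , es , .(length gs)) (stateInvariant refl width sources innerEdges uniqueLower uniqueUpper) =
  stateInvariant (sym (trans (length-++ gs) (+-comm _ 1)))
    (trans (length-splice k a st N width) (cong (λ x → k + x + l) (trans (length-map _ (upTo o)) (length-upTo o))))
    (All.++⁺ (All.take⁺ k sources′) (All.++⁺ new-sources (All.drop⁺ (k + a) sources′)))
    (All.++⁺ (All.map (λ ((va , sa) , (vb , sb) , nb) → (weaken va , sa) , (weaken vb , sb) , nb) innerEdges)
             (All-zipWith _ (All.take⁺ a (All.drop⁺ k sources′)) new-targets))
    (subst (λ ys → Unique (ys ++ _)) (sym (trans (map-++ proj₁ es newEdges) (cong (map proj₁ es ++_) lower-new)))
       (Unique-splice k a (map proj₁ es) st N uniqueLower (new-ports-unique (node c) hi o)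
          (disjoint (All.map⁺ (All.applyUpTo⁺₂ _ o (λ _ → refl)))
                    (All.++⁺ (All.map⁺ (All.map (λ ((va , _) , _) → old va) innerEdges)) (All.map (λ (v , _) → old v) sources))
                    λ new≡ old≢ → old≢ new≡)))
    (subst Unique (sym (trans (map-++ proj₂ es newEdges) (cong (map proj₂ es ++_) upper-new)))
       (Unique.++⁺ uniqueUpper (new-ports-unique (node c) lo a)
          (disjoint (All.map⁺ (All.map (λ (_ , (vb , _) , _) → old vb) innerEdges))
                    (All.map⁺ (All.applyUpTo⁺₂ _ a (λ _ → refl))) λ old≢ new≡ → old≢ new≡)))
  where
  a = arIn g
  o = arOut g
  c = length gs
  X = take a (drop k st)
  N = map (port (node c) hi) (upTo o)
  newEdges = zipWith (λ p q → (p , port (node c) lo q)) X (upTo a)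

  weaken : ∀ {p} → ValidPort gs p → ValidPort (gs ++ [ g ]) p
  weaken = ValidPort-++ gs [ g ] _

  old : ∀ {p} → ValidPort gs p → vtx p ≢ node c
  old = ValidPort-fresh gs _

  sources′ : All (Source (gs ++ [ g ])) st
  sources′ = All.map (λ (v , s) → weaken v , s) sources

  new-sources : All (Source (gs ++ [ g ])) N
  new-sources = All.map⁺ (All.applyUpTo⁺₁ _ o (λ b<o → (g , kindAt-snoc gs g , leg-out g b<o) , refl))

  new-targets : All (λ q → Target (gs ++ [ g ]) (port (node c) lo q) × IsNode (node c)) (upTo a)
  new-targets = All.applyUpTo⁺₁ _ a (λ q<a → ((g , kindAt-snoc gs g , leg-in g q<a) , refl) , isNode c)

  length-X : length X ≡ length (upTo a)
  length-X = trans (length-take-+ a (drop k st) (length-drop-+ k st (trans width (+-assoc k a l)))) (sym (length-upTo a))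

  lower-new : map proj₁ newEdges ≡ X
  lower-new = map-proj₁-zipWith _ X (upTo a) length-X

  upper-new : map proj₂ newEdges ≡ map (port (node c) lo) (upTo a)
  upper-new = map-proj₂-zipWith _ X (upTo a) length-X

trace-invariant : ∀ {n k} (D : Diagram n k) → TraceInvariant (gens D) k (traceD D)
trace-invariant {n} idD =
  stateInvariant refl (trans (length-map _ (upTo n)) (length-upTo n))
    (All.map⁺ (All.applyUpTo⁺₂ _ n (λ _ → (refl , refl) , refl))) [] (Unique.map⁺ inp-injective (Unique.upTo⁺ n)) []
  where
  inp-injective : ∀ {i j} → port (inp i) hi 0 ≡ port (inp j) hi 0 → i ≡ j
  inp-injective refl = refl
trace-invariant (layer k g l D) rewrite traceD-layer k g l D = traceStep-invariant (gens D) k g l (traceD D) (trace-invariant D)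

record WellFormedEdges (gs : List Gen) (es : List (Port × Port)) : Set where
  field
    oriented    : All (λ (a , b) → Source gs a × Target gs b) es
    lowerUnique : Unique (map proj₁ es)
    upperUnique : Unique (map proj₂ es)

edges-wellFormed : ∀ {n k} (D : Diagram n k) → WellFormedEdges (gens D) (edges D)
edges-wellFormed {k = k} D with traceD D | trace-invariant D
... | st , es , c | stateInvariant _ width sources innerEdges uniqueLower uniqueUpper = record
  { oriented    = All.++⁺ (All.map (λ (sa , tb , _) → sa , tb) innerEdges)
                          (All-zipWith _ sources (All.applyUpTo⁺₂ _ k (λ _ → (refl , refl) , refl)))
  ; lowerUnique = subst Unique (sym (trans (map-++ proj₁ es _) (cong (map proj₁ es ++_) (map-proj₁-zipWith _ st (upTo k) length-st))))
                    uniqueLower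
  ; upperUnique = subst Unique (sym (trans (map-++ proj₂ es _) (cong (map proj₂ es ++_) (map-proj₂-zipWith _ st (upTo k) length-st))))
                    (Unique.++⁺ uniqueUpper (Unique.map⁺ outp-injective (Unique.upTo⁺ k))
                       (disjoint {Q = λ p → ∃[ j ] vtx p ≡ outp j}
                                 (All.map⁺ (All.map (λ (_ , _ , nb) → nb) innerEdges))
                                 (All.map⁺ (All.applyUpTo⁺₂ _ k (λ j → j , refl)))
                                 λ { (isNode _) (_ , ()) }))
  }
  where
  length-st : length st ≡ length (upTo k)
  length-st = trans width (sym (length-upTo k))
  outp-injective : ∀ {i j} → port (outp i) lo 0 ≡ port (outp j) lo 0 → i ≡ j
  outp-injective refl = refl

firstPort-++ : ∀ xs ys {a} → firstPort xs ≡ just a → firstPort (xs ++ ys) ≡ just a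
firstPort-++ (_ ∷ _) ys e = e

lastPort-++ : ∀ xs ys {b} → lastPort ys ≡ just b → lastPort (xs ++ ys) ≡ just b
lastPort-++ []           ys       e = e
lastPort-++ (_ ∷ [])     (_ ∷ _)  e = e
lastPort-++ (_ ∷ x ∷ xs) ys       e = lastPort-++ (x ∷ xs) ys e

lastPort-∷ʳ : ∀ xs e → lastPort (xs ∷ʳ e) ≡ just (proj₂ e)
lastPort-∷ʳ xs e = lastPort-++ xs [ e ] refl

lastPort-nonempty : ∀ s r → ∃[ b ] lastPort (s ∷ r) ≡ just b
lastPort-nonempty s []      = proj₂ s , refl
lastPort-nonempty s (t ∷ r) = lastPort-nonempty t r

junctions-++ : ∀ xs ys {b c} → lastPort xs ≡ just b → firstPort ys ≡ just c →
               junctions (xs ++ ys) ≡ junctions xs ++ (b , c) ∷ junctions ys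
junctions-++ ((_ , _) ∷ [])    ((_ , _) ∷ _) refl refl = refl
junctions-++ (s ∷ s′ ∷ xs) ys eb ec = cong ((proj₂ s , proj₁ s′) ∷_) (junctions-++ (s′ ∷ xs) ys eb ec)

reverseWalk : List (Port × Port) → List (Port × Port)
reverseWalk ps = reverse (map swap ps)

reverseWalk-∷ : ∀ s r → reverseWalk (s ∷ r) ≡ reverseWalk r ∷ʳ swap s
reverseWalk-∷ s r = unfold-reverse (swap s) (map swap r)

reverseWalk-involutive : ∀ ps → reverseWalk (reverseWalk ps) ≡ ps
reverseWalk-involutive ps = begin
  reverse (map swap (reverse (map swap ps))) ≡⟨ cong reverse (reverse-map swap (map swap ps)) ⟩
  reverse (reverse (map swap (map swap ps))) ≡⟨ reverse-involutive _ ⟩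
  map swap (map swap ps)                     ≡⟨ map-∘ ps ⟨
  map (swap ∘ swap) ps                       ≡⟨ map-id ps ⟩
  ps                                         ∎
  where open ≡-Reasoning

length-reverseWalk : ∀ ps → length (reverseWalk ps) ≡ length ps
length-reverseWalk ps = trans (length-reverse (map swap ps)) (length-map swap ps)

firstPort-reverseWalk : ∀ ps → firstPort (reverseWalk ps) ≡ lastPort ps
firstPort-reverseWalk []          = refl
firstPort-reverseWalk (s ∷ [])    = refl
firstPort-reverseWalk (s ∷ t ∷ r) = begin
  firstPort (reverseWalk (s ∷ t ∷ r))       ≡⟨ cong firstPort (reverseWalk-∷ s (t ∷ r)) ⟩
  firstPort (reverseWalk (t ∷ r) ∷ʳ swap s) ≡⟨ firstPort-++ (reverseWalk (t ∷ r)) _ (trans (firstPort-reverseWalk (t ∷ r)) (proj₂ last)) ⟩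
  just (proj₁ last)                         ≡⟨ proj₂ last ⟨
  lastPort (t ∷ r)                          ∎
  where
  open ≡-Reasoning
  last = lastPort-nonempty t r

lastPort-reverseWalk : ∀ s r → lastPort (reverseWalk (s ∷ r)) ≡ just (proj₁ s)
lastPort-reverseWalk s r = trans (cong lastPort (reverseWalk-∷ s r)) (lastPort-∷ʳ (reverseWalk r) (swap s))

junctions-reverseWalk : ∀ ps → junctions (reverseWalk ps) ≡ reverseWalk (junctions ps)
junctions-reverseWalk []          = refl
junctions-reverseWalk (s ∷ [])    = refl
junctions-reverseWalk (s ∷ t ∷ r) = begin
  junctions (reverseWalk (s ∷ t ∷ r))                          ≡⟨ cong junctions (reverseWalk-∷ s (t ∷ r)) ⟩
  junctions (reverseWalk (t ∷ r) ++ [ swap s ])                ≡⟨ junctions-++ (reverseWalk (t ∷ r)) _ (lastPort-reverseWalk t r) refl ⟩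
  junctions (reverseWalk (t ∷ r)) ∷ʳ (proj₁ t , proj₂ s)       ≡⟨ cong (_∷ʳ (proj₁ t , proj₂ s)) (junctions-reverseWalk (t ∷ r)) ⟩
  reverseWalk (junctions (t ∷ r)) ∷ʳ (proj₁ t , proj₂ s)       ≡⟨ reverseWalk-∷ (proj₂ s , proj₁ t) (junctions (t ∷ r)) ⟨
  reverseWalk (junctions (s ∷ t ∷ r))                          ∎
  where open ≡-Reasoning

stepStarts : List (Port × Port) → List Vtx
stepStarts = map (vtx ∘ proj₁)

stepStarts-interior : ∀ s r → All GoodJunction (junctions (s ∷ r)) → stepStarts (s ∷ r) ≡ vtx (proj₁ s) ∷ interior (s ∷ r)
stepStarts-interior s []      _                  = refl
stepStarts-interior s (t ∷ r) ((vtx≡ , _) ∷ goods) =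
  cong (vtx (proj₁ s) ∷_) (trans (stepStarts-interior t r goods) (cong (_∷ interior (t ∷ r)) (sym vtx≡)))

sumTurns : (Port × Port → ℤ) → List (Port × Port) → ℤ
sumTurns t = foldr (λ j z → t j +ℤ z) 0ℤ

sumTurns-++ : ∀ t xs ys → sumTurns t (xs ++ ys) ≡ sumTurns t xs +ℤ sumTurns t ys
sumTurns-++ t []       ys = sym (ℤₚ.+-identityˡ _)
sumTurns-++ t (x ∷ xs) ys = trans (cong (t x +ℤ_) (sumTurns-++ t xs ys)) (sym (ℤₚ.+-assoc (t x) _ _))

sumTurns-reverseWalk : ∀ t js → All (λ j → t (swap j) ≡ - t j) js → sumTurns t (reverseWalk js) ≡ - sumTurns t js
sumTurns-reverseWalk t []       []              = refl
sumTurns-reverseWalk t (j ∷ js) (antisym ∷ all) = begin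
  sumTurns t (reverseWalk (j ∷ js))                 ≡⟨ cong (sumTurns t) (reverseWalk-∷ j js) ⟩
  sumTurns t (reverseWalk js ++ [ swap j ])         ≡⟨ sumTurns-++ t (reverseWalk js) _ ⟩
  sumTurns t (reverseWalk js) +ℤ (t (swap j) +ℤ 0ℤ) ≡⟨ cong₂ _+ℤ_ (sumTurns-reverseWalk t js all) (trans (ℤₚ.+-identityʳ _) antisym) ⟩
  - sumTurns t js +ℤ - t j                          ≡⟨ ℤₚ.+-comm (- sumTurns t js) (- t j) ⟩
  - t j +ℤ - sumTurns t js                          ≡⟨ ℤₚ.neg-distrib-+ (t j) _ ⟨
  - sumTurns t (j ∷ js)                             ∎
  where open ≡-Reasoning

sumTurns-constant : ∀ t {τ} js → All (λ j → t j ≡ τ) js → sumTurns t js ≡ ℤ.+ length js ℤ.* τ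
sumTurns-constant t         []       []         = refl
sumTurns-constant t {τ} (j ∷ js) (tj≡τ ∷ all) =
  trans (cong₂ _+ℤ_ tj≡τ (sumTurns-constant t js all)) (sym (ℤₚ.suc-* (ℤ.+ length js) τ))

sumTurns-sign≢0 : ∀ t {τ} j js → IsSign τ → All (λ j → t j ≡ τ) (j ∷ js) → sumTurns t (j ∷ js) ≢ 0ℤ
sumTurns-sign≢0 t j js (inj₁ refl) all sum≡0 with () ← trans (sym (sumTurns-constant t (j ∷ js) all)) sum≡0
sumTurns-sign≢0 t j js (inj₂ refl) all sum≡0 with () ← trans (sym (sumTurns-constant t (j ∷ js) all)) sum≡0

oddℕ : ℕ → Bool
oddℕ zero    = false
oddℕ (suc n) = not (oddℕ n)

odd : ℤ → Bool
odd (ℤ.+ n)    = oddℕ n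
odd ℤ.-[1+ n ] = not (oddℕ n)

odd-sign-+ : ∀ {t} z → IsSign t → odd (t +ℤ z) ≡ not (odd z)
odd-sign-+ (ℤ.+ n)          (inj₁ refl) = refl
odd-sign-+ ℤ.-[1+ zero ]    (inj₁ refl) = refl
odd-sign-+ ℤ.-[1+ suc n ]   (inj₁ refl) = sym (not-involutive _)
odd-sign-+ (ℤ.+ zero)       (inj₂ refl) = refl
odd-sign-+ (ℤ.+ suc n)      (inj₂ refl) = sym (not-involutive _)
odd-sign-+ ℤ.-[1+ n ]       (inj₂ refl) = refl

_≟ᵛ_ : DecidableEquality Vtx
inp i  ≟ᵛ inp j  = Dec.map′ (cong inp) (λ { refl → refl }) (i ℕ.≟ j)
outp i ≟ᵛ outp j = Dec.map′ (cong outp) (λ { refl → refl }) (i ℕ.≟ j)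
node i ≟ᵛ node j = Dec.map′ (cong node) (λ { refl → refl }) (i ℕ.≟ j)
inp _  ≟ᵛ outp _ = no λ ()
inp _  ≟ᵛ node _ = no λ ()
outp _ ≟ᵛ inp _  = no λ ()
outp _ ≟ᵛ node _ = no λ ()
node _ ≟ᵛ inp _  = no λ ()
node _ ≟ᵛ outp _ = no λ ()

open import Data.List.Membership.DecPropositional _≟ᵛ_ using (_∈?_)

_≟ˢ_ : DecidableEquality Side
lo ≟ˢ lo = yes refl
hi ≟ˢ hi = yes refl
lo ≟ˢ hi = no λ ()
hi ≟ˢ lo = no λ ()

_≟ᵖ_ : DecidableEquality Port
port v s l ≟ᵖ port v′ s′ l′ =
  Dec.map′ (λ { (refl , refl , refl) → refl }) (λ { refl → refl , refl , refl })
           (v ≟ᵛ v′ ×-dec s ≟ˢ s′ ×-dec l ℕ.≟ l′)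

module Graph {n k : ℕ} (D : Diagram n k) where

  private
    gs = gens D
    open WellFormedEdges (edges-wellFormed D)

  lower-hi : ∀ {a b} → (a , b) ∈ edges D → side a ≡ hi
  lower-hi e = proj₂ (proj₁ (All.lookup oriented e))

  upper-lo : ∀ {a b} → (a , b) ∈ edges D → side b ≡ lo
  upper-lo e = proj₂ (proj₂ (All.lookup oriented e))

  Step-sym : ∀ {a b} → Step D (a , b) → Step D (b , a)
  Step-sym (inj₁ e) = inj₂ e
  Step-sym (inj₂ e) = inj₁ e

  Step-source-valid : ∀ {a b} → Step D (a , b) → ValidPort gs a
  Step-source-valid (inj₁ e) = proj₁ (proj₁ (All.lookup oriented e))
  Step-source-valid (inj₂ e) = proj₁ (proj₂ (All.lookup oriented e))

  Step-target-valid : ∀ {a b} → Step D (a , b) → ValidPort gs b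
  Step-target-valid s = Step-source-valid (Step-sym s)

  Step-flips : ∀ {a b} → Step D (a , b) → side b ≡ flipSide (side a)
  Step-flips (inj₁ e) rewrite lower-hi e = upper-lo e
  Step-flips (inj₂ e) rewrite upper-lo e = lower-hi e

  Step-irreflexive : ∀ {a} → ¬ Step D (a , a)
  Step-irreflexive {a} s = flipSide-≢ (side a) (Step-flips s)

  Step-functional : ∀ {a b b′} → Step D (a , b) → Step D (a , b′) → b ≡ b′
  Step-functional (inj₁ e) (inj₁ e′) = cong proj₂ (Unique-map-injective proj₁ lowerUnique e e′ refl)
  Step-functional (inj₂ e) (inj₂ e′) = cong proj₁ (Unique-map-injective proj₂ upperUnique e e′ refl)
  Step-functional (inj₁ e) (inj₂ e′) = ⊥-elim (hi≢lo (trans (sym (lower-hi e)) (upper-lo e′)))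
  Step-functional (inj₂ e) (inj₁ e′) = ⊥-elim (hi≢lo (trans (sym (lower-hi e′)) (upper-lo e)))

  leg-of : ∀ {p g} → ValidPort gs p → vkind D (vtx p) ≡ just g → Leg g (side p) (leg p)
  leg-of {port (node x) _ _} (g′ , e′ , lg) e with trans (sym e) e′
  ... | refl = lg

  junction-turning : ∀ {b c} → ValidPort gs b → ValidPort gs c → GoodJunction (b , c) →
                     Turning (side b) (side c) (turnAt D (b , c))
  junction-turning {port (inp _)  _ _} (refl , refl) (refl , refl) (refl , b≢c) = ⊥-elim (b≢c refl)
  junction-turning {port (outp _) _ _} (refl , refl) (refl , refl) (refl , b≢c) = ⊥-elim (b≢c refl)
  junction-turning {port (node x) _ _} (g , e , lg) (g′ , e′ , lg′) (refl , b≢c) with trans (sym e) e′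
  ... | refl rewrite e = leg-turning (node x) (node x) lg lg′ λ { refl refl → b≢c refl }

  junction-turn-antisym : ∀ {b c} → ValidPort gs b → ValidPort gs c → GoodJunction (b , c) →
                          turnAt D (c , b) ≡ - turnAt D (b , c)
  junction-turn-antisym {port (inp _)  _ _} (refl , refl) (refl , refl) (refl , _) = refl
  junction-turn-antisym {port (outp _) _ _} (refl , refl) (refl , refl) (refl , _) = refl
  junction-turn-antisym {port (node x) _ _} (g , e , lg) (g′ , e′ , lg′) (refl , _) with trans (sym e) e′
  ... | refl rewrite e = leg-turn-antisym (node x) (node x) lg lg′

  Walk : List (Port × Port) → Set
  Walk ps = All (Step D) ps × All GoodJunction (junctions ps)

  All-reverseWalk : ∀ {P : Port × Port → Set} {ps} → All (P ∘ swap) ps → All P (reverseWalk ps)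
  All-reverseWalk {ps = ps} all = ↭.All-resp-↭ (↭-sym (↭.↭-reverse (map swap ps))) (All.map⁺ all)

  Walk-++ : ∀ xs ys {b c} → lastPort xs ≡ just b → firstPort ys ≡ just c →
            Walk xs → GoodJunction (b , c) → Walk ys → Walk (xs ++ ys)
  Walk-++ xs ys eb ec (sx , jx) j (sy , jy) =
    All.++⁺ sx sy , subst (All GoodJunction) (sym (junctions-++ xs ys eb ec)) (All.++⁺ jx (j ∷ jy))

  Walk-++⁻ : ∀ xs ys {b c} → lastPort xs ≡ just b → firstPort ys ≡ just c →
             Walk (xs ++ ys) → Walk xs × GoodJunction (b , c) × Walk ys
  Walk-++⁻ xs ys eb ec (sxy , jxy) with All.++⁻ xs sxy | All.++⁻ (junctions xs) (subst (All GoodJunction) (junctions-++ xs ys eb ec) jxy)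
  ... | sx , sy | jx , j ∷ jy = (sx , jx) , j , (sy , jy)

  Walk-reverse : ∀ {ps} → Walk ps → Walk (reverseWalk ps)
  Walk-reverse {ps} (steps , goods) =
    All-reverseWalk (All.map Step-sym steps) ,
    subst (All GoodJunction) (sym (junctions-reverseWalk ps)) (All-reverseWalk (All.map (λ (e , b≢c) → sym e , b≢c ∘ sym) goods))

  ValidJunction : Port × Port → Set
  ValidJunction (b , c) = ValidPort gs b × ValidPort gs c × GoodJunction (b , c)

  Walk-junctions : ∀ {ps} → Walk ps → All ValidJunction (junctions ps)
  Walk-junctions {[]}        _                             = []
  Walk-junctions {_ ∷ []}    _                             = []
  Walk-junctions {_ ∷ _ ∷ _} (s ∷ t ∷ steps , j ∷ goods) =
    (Step-target-valid s , Step-source-valid t , j) ∷ Walk-junctions (t ∷ steps , goods)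

  twist-++ : ∀ xs ys {b c} → lastPort xs ≡ just b → firstPort ys ≡ just c →
             twist D (xs ++ ys) ≡ twist D xs +ℤ (turnAt D (b , c) +ℤ twist D ys)
  twist-++ xs ys eb ec = trans (cong (sumTurns (turnAt D)) (junctions-++ xs ys eb ec)) (sumTurns-++ (turnAt D) (junctions xs) _)

  twist-reverseWalk : ∀ {ps} → Walk ps → twist D (reverseWalk ps) ≡ - twist D ps
  twist-reverseWalk {ps} walk =
    trans (cong (sumTurns (turnAt D)) (junctions-reverseWalk ps))
          (sumTurns-reverseWalk (turnAt D) (junctions ps) (All.map (λ (vb , vc , j) → junction-turn-antisym vb vc j) (Walk-junctions walk)))

  -- Closed walks contain cycles

  Walk-tail : ∀ {s r} → Walk (s ∷ r) → Walk r
  Walk-tail {r = []}    _                    = [] , []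
  Walk-tail {r = _ ∷ _} (_ ∷ steps , _ ∷ goods) = steps , goods

  ClosedWalk : List (Port × Port) → Set
  ClosedWalk ps = ∃[ w ] IsPath D w w ps

  ShorterClosedWalk : List (Port × Port) → Set
  ShorterClosedWalk ps = ∃[ qs ] ClosedWalk qs × length qs < length ps

  unique-or-shorter : ∀ ps → Walk ps → Unique (stepStarts ps) ⊎ ShorterClosedWalk ps
  unique-or-shorter []      _    = inj₁ []
  unique-or-shorter (s ∷ r) walk with vtx (proj₁ s) ∈? stepStarts r
  ... | no s∉r = Sum.map (¬Any⇒All¬ _ s∉r ∷_) (λ (qs , closed , <) → qs , closed , m<n⇒m<1+n <) (unique-or-shorter r (Walk-tail walk))
  ... | yes s∈r with ∈-map⁻ (vtx ∘ proj₁) s∈r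
  ... | t , t∈r , vtx≡ with ∈-∃++ t∈r
  ... | pre , post , refl with lastPort-nonempty s pre
  ... | b , eb with Walk-++⁻ (s ∷ pre) (t ∷ post) eb refl walk
  ... | (steps , goods) , (vtx-b≡ , _) , _ =
    inj₂ (s ∷ pre , (vtx (proj₁ s) , steps , goods , refl , trans (cong mvtx eb) (cong just (trans vtx-b≡ (sym vtx≡)))) ,
          s≤s (length-<-++ pre t post))

  -- a closed walk returning through its first port ends by retracing its first edge
  returning-shorter : ∀ ps → ClosedWalk ps → firstPort ps ≡ lastPort ps → ShorterClosedWalk ps
  returning-shorter ps closed first≡last with initLast ps
  returning-shorter .[] (_ , _ , _ , () , _) _ | []
  returning-shorter .([] ∷ʳ s) (_ , step ∷ [] , _) first≡last | [] ∷ʳ′ s =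
    ⊥-elim (Step-irreflexive (subst (λ b → Step D (proj₁ s , b)) (sym (just-injective first≡last)) step))
  returning-shorter .((s ∷ mid) ∷ʳ t) (_ , steps , goods , _) first≡last | (s ∷ mid) ∷ʳ′ t
    with All.++⁻ (s ∷ mid) steps | lastPort-nonempty s mid
  ... | s-step ∷ _ , t-step ∷ [] | b , eb
    with Walk-++⁻ (s ∷ mid) [ t ] eb refl (steps , goods)
  ... | walk , (vtx-b≡ , b≢t) , _ = backtrack mid eb walk vtx-b≡ b≢t
    where
    t-returns : proj₂ t ≡ proj₁ s
    t-returns = just-injective (trans (sym (lastPort-∷ʳ (s ∷ mid) t)) (sym first≡last))
    s-ends-at-t : proj₂ s ≡ proj₁ t
    s-ends-at-t = Step-functional s-step (Step-sym (subst (λ a → Step D (proj₁ t , a)) t-returns t-step))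
    backtrack : ∀ mid {b} → lastPort (s ∷ mid) ≡ just b → Walk (s ∷ mid) → vtx b ≡ vtx (proj₁ t) → b ≢ proj₁ t →
                ShorterClosedWalk (s ∷ mid ++ [ t ])
    backtrack []        refl _ _ b≢t = ⊥-elim (b≢t s-ends-at-t)
    backtrack (e ∷ mid) eb (_ ∷ steps , (vtx-sm , _) ∷ goods) vtx-b≡ _ =
      e ∷ mid ,
      (vtx (proj₁ e) , steps , goods , refl ,
       trans (cong mvtx eb) (cong just (trans vtx-b≡ (trans (cong vtx (sym s-ends-at-t)) vtx-sm)))) ,
      m<n⇒m<1+n (length-<-++ (e ∷ mid) t [])

  cycle-or-shorter : ∀ ps → ClosedWalk ps → IsCycle D ps ⊎ ShorterClosedWalk ps
  cycle-or-shorter []      (_ , _ , _ , () , _)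
  cycle-or-shorter (s ∷ r) closed@(w , steps , goods , ef , el) with unique-or-shorter (s ∷ r) (steps , goods)
  ... | inj₂ shorter = inj₂ shorter
  ... | inj₁ unique with Maybe.≡-dec _≟ᵖ_ (firstPort (s ∷ r)) (lastPort (s ∷ r))
  ... | yes first≡last = inj₂ (returning-shorter (s ∷ r) closed first≡last)
  ... | no first≢last  = inj₁ (w , (steps , goods , ef , el) ,
                               subst (λ v → Unique (v ∷ interior (s ∷ r))) (just-injective ef)
                                     (subst Unique (stepStarts-interior s r goods) unique) ,
                               first≢last)

  closed-walk-cycle : ∀ ps → Acc _<_ (length ps) → ClosedWalk ps → ∃ (IsCycle D)
  closed-walk-cycle ps (acc smaller) closed with cycle-or-shorter ps closed
  ... | inj₁ cycle                = ps , cycle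
  ... | inj₂ (qs , closed′ , <) = closed-walk-cycle qs (smaller <) closed′

  acyclic⇒no-closed-walk : Acyclic D → ∀ {w ps} → ¬ IsPath D w w ps
  acyclic⇒no-closed-walk acyclic {w} {ps} path = acyclic (closed-walk-cycle ps (<-wellFounded (length ps)) (w , path))

  path-walk : ∀ {x y ps} → IsPath D x y ps → Walk ps
  path-walk (steps , goods , _) = steps , goods

  path-tail : ∀ {x y s t r} → IsPath D x y (s ∷ t ∷ r) → IsPath D (vtx (proj₂ s)) y (t ∷ r)
  path-tail (_ ∷ steps , (vtx≡ , _) ∷ goods , _ , last) = steps , goods , cong just (sym vtx≡) , last

  path-reverse : ∀ {x y ps} → IsPath D x y ps → IsPath D y x (reverseWalk ps)
  path-reverse {ps = s ∷ r} path@(_ , _ , first , last) =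
    let (steps , goods) = Walk-reverse (path-walk path)
    in steps , goods , trans (cong mvtx (firstPort-reverseWalk (s ∷ r))) last , trans (cong mvtx (lastPort-reverseWalk s r)) first

  path-++ : ∀ {x y z P Q b c} → IsPath D x y P → GoodJunction (b , c) → IsPath D y z Q →
            lastPort P ≡ just b → firstPort Q ≡ just c → IsPath D x z (P ++ Q)
  path-++ {P = s ∷ P} {Q = t ∷ Q} pathP j pathQ@(_ , _ , _ , lastQ) eb ec =
    let (steps , goods) = Walk-++ (s ∷ P) (t ∷ Q) eb ec (path-walk pathP) j (path-walk pathQ)
        (b′ , eb′) = lastPort-nonempty t Q
    in steps , goods , proj₁ (proj₂ (proj₂ pathP)) , trans (cong mvtx (lastPort-++ (s ∷ P) (t ∷ Q) eb′)) (trans (cong mvtx (sym eb′)) lastQ)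

  path-++-reverse : ∀ {x y P Q b b′} → IsPath D x y P → IsPath D x y Q → lastPort P ≡ just b → lastPort Q ≡ just b′ →
                    b ≢ b′ → IsPath D x x (P ++ reverseWalk Q)
  path-++-reverse {Q = Q} {b} {b′} pathP@(_ , _ , _ , lastP) pathQ@(_ , _ , _ , lastQ) eb eb′ b≢b′ =
    path-++ pathP (vtx-b≡vtx-b′ , b≢b′) (path-reverse pathQ) eb (trans (firstPort-reverseWalk Q) eb′)
    where
    vtx-b≡vtx-b′ : vtx b ≡ vtx b′
    vtx-b≡vtx-b′ = just-injective (trans (sym (cong mvtx eb)) (trans lastP (trans (sym lastQ) (cong mvtx eb′))))

  -- every step changes side, and exactly the junctions between legs on the same side turn, by ±1
  twist-parity : ∀ s r {b} → Walk (s ∷ r) → lastPort (s ∷ r) ≡ just b →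
                 odd (twist D (s ∷ r)) ≡ sameSide (side (proj₁ s)) (side b)
  twist-parity s [] (step ∷ [] , []) refl rewrite Step-flips step = sym (sameSide-flipSide (side (proj₁ s)))
  twist-parity s (t ∷ r) {b} (step ∷ steps , j ∷ goods) eb
    with junction-turning (Step-target-valid step) (Step-source-valid (All.head steps)) j
  ... | inj₁ (same , sign) = begin
    odd (turnAt D (proj₂ s , proj₁ t) +ℤ twist D (t ∷ r)) ≡⟨ odd-sign-+ (twist D (t ∷ r)) sign ⟩
    not (odd (twist D (t ∷ r)))                           ≡⟨ cong not (twist-parity t r (steps , goods) eb) ⟩
    not (sameSide (side (proj₁ t)) (side b))              ≡⟨ cong (λ x → not (sameSide x (side b))) (trans (sym same) (Step-flips step)) ⟩
    not (sameSide (flipSide (side (proj₁ s))) (side b))   ≡⟨ sameSide-flip (side (proj₁ s)) (side b) ⟩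
    sameSide (side (proj₁ s)) (side b)                    ∎
    where open ≡-Reasoning
  ... | inj₂ (differ , straight) = begin
    odd (turnAt D (proj₂ s , proj₁ t) +ℤ twist D (t ∷ r)) ≡⟨ cong (λ x → odd (x +ℤ twist D (t ∷ r))) straight ⟩
    odd (0ℤ +ℤ twist D (t ∷ r))                           ≡⟨ cong odd (ℤₚ.+-identityˡ (twist D (t ∷ r))) ⟩
    odd (twist D (t ∷ r))                                 ≡⟨ twist-parity t r (steps , goods) eb ⟩
    sameSide (side (proj₁ t)) (side b)                    ≡⟨ cong (λ x → sameSide x (side b)) (≢-flipSide t-not-flipped) ⟩
    sameSide (side (proj₁ s)) (side b)                    ∎
    where
    open ≡-Reasoning
    t-not-flipped : side (proj₁ t) ≢ flipSide (side (proj₁ s))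
    t-not-flipped eq = differ (trans (Step-flips step) (sym eq))

  lastPort-valid : ∀ {ps b} → All (Step D) ps → lastPort ps ≡ just b → ValidPort gs b
  lastPort-valid (step ∷ [])            refl = Step-target-valid step
  lastPort-valid (_ ∷ steps@(_ ∷ _)) eb   = lastPort-valid steps eb

  -- the output wire is entered from below
  departs-upward : ∀ {x j s r} → IsPath D x (outp j) (s ∷ r) → twist D (s ∷ r) ≡ 0ℤ → side (proj₁ s) ≡ hi
  departs-upward {s = s} {r} (steps , goods , _ , last) untwisted with lastPort-nonempty s r
  ... | port (inp _)  _ _ , eb with () ← trans (sym (cong mvtx eb)) last
  ... | port (node _) _ _ , eb with () ← trans (sym (cong mvtx eb)) last
  ... | port (outp _) _ _ , eb with lastPort-valid steps eb
  ... | refl , refl = upward (side (proj₁ s)) (trans (sym (twist-parity s r (steps , goods) eb)) (cong odd untwisted))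
    where
    upward : ∀ s → sameSide s lo ≡ false → s ≡ hi
    upward hi _ = refl

  cup-side : ∀ {p} → ValidPort gs p → vkind D (vtx p) ≡ just cup → side p ≡ hi
  cup-side valid kind with leg-of valid kind
  ... | cup-out₀ = refl
  ... | cup-out₁ = refl

  cap-side : ∀ {p} → ValidPort gs p → vkind D (vtx p) ≡ just cap → side p ≡ lo
  cap-side valid kind with leg-of valid kind
  ... | cap-in₀ = refl
  ... | cap-in₁ = refl

  cupcap-side : ∀ {p q} → ValidPort gs p → ValidPort gs q → vtx p ≡ vtx q → IsCupCap D (vtx p) → side p ≡ side q
  cupcap-side vp vq refl (inj₁ kind) = trans (cup-side vp kind) (sym (cup-side vq kind))
  cupcap-side vp vq refl (inj₂ kind) = trans (cap-side vp kind) (sym (cap-side vq kind))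

  cupcap-turn-sign : ∀ {b c} → ValidJunction (b , c) → IsCupCap D (vtx b) → IsSign (turnAt D (b , c))
  cupcap-turn-sign (vb , vc , j@(vtx≡ , _)) cc with junction-turning vb vc j
  ... | inj₁ (_ , sign)       = sign
  ... | inj₂ (differ , _)     = ⊥-elim (differ (cupcap-side vb vc vtx≡ cc))

  CupCapPair : Vtx → Vtx → Set
  CupCapPair x y = (vkind D x ≡ just cup × vkind D y ≡ just cap) ⊎ (vkind D x ≡ just cap × vkind D y ≡ just cup)

  -- two cups (or two caps) cannot be adjacent: their legs lie on the same side, but a step changes side
  cupcap-alternate : ∀ {a b} → Step D (a , b) → IsCupCap D (vtx a) → IsCupCap D (vtx b) → CupCapPair (vtx a) (vtx b)
  cupcap-alternate step (inj₁ ka) (inj₂ kb) = inj₁ (ka , kb)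
  cupcap-alternate step (inj₂ ka) (inj₁ kb) = inj₂ (ka , kb)
  cupcap-alternate {a} step (inj₁ ka) (inj₁ kb) =
    ⊥-elim (flipSide-≢ (side a) (trans (cup-side (Step-source-valid step) ka) (trans (sym (cup-side (Step-target-valid step) kb)) (Step-flips step))))
  cupcap-alternate {a} step (inj₂ ka) (inj₂ kb) =
    ⊥-elim (flipSide-≢ (side a) (trans (cap-side (Step-source-valid step) ka) (trans (sym (cap-side (Step-target-valid step) kb)) (Step-flips step))))

  cupcap-other-port : ∀ {b c c′} → ValidPort gs b → ValidPort gs c → ValidPort gs c′ → IsCupCap D (vtx b) →
                      GoodJunction (b , c) → GoodJunction (b , c′) → c ≡ c′
  cupcap-other-port {b} {c} {c′} vb vc vc′ cc (vtx≡ , b≢c) (vtx≡′ , b≢c′) =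
    port-≡ (trans (sym vtx≡) vtx≡′) (legs-equal cc)
    where
    legs-equal : IsCupCap D (vtx b) → (side c , leg c) ≡ (side c′ , leg c′)
    legs-equal (inj₁ kind) =
      two-legged (inj₁ refl) (leg-of vb kind) (leg-of vc (subst _ vtx≡ kind)) (leg-of vc′ (subst _ vtx≡′ kind))
                 (b≢c ∘ port-≡ vtx≡) (b≢c′ ∘ port-≡ vtx≡′)
    legs-equal (inj₂ kind) =
      two-legged (inj₂ refl) (leg-of vb kind) (leg-of vc (subst _ vtx≡ kind)) (leg-of vc′ (subst _ vtx≡′ kind))
                 (b≢c ∘ port-≡ vtx≡) (b≢c′ ∘ port-≡ vtx≡′)

  -- cups and caps have two legs, so a walk through them cannot branch
  wire-prefix : ∀ W P {y} → Walk W → Walk P → firstPort W ≡ firstPort P → All (IsCupCap D) (interior W) →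
                mvtx (lastPort P) ≡ just y → ¬ IsCupCap D y → ∃[ T ] P ≡ W ++ T
  wire-prefix []      P _ _ _ _ _ _ = P , refl
  wire-prefix (_ ∷ _) [] _ _ () _ _ _
  wire-prefix ((a , b) ∷ W) ((a , b′) ∷ P) (s ∷ _ , _) (s′ ∷ _ , _) refl ccs last ¬cc
    with Step-functional s s′
  wire-prefix ((a , b) ∷ []) ((a , b) ∷ P) _ _ refl _ _ _ | refl = P , refl
  wire-prefix ((a , b) ∷ t ∷ W) ((a , b) ∷ []) _ _ refl (cc ∷ _) last ¬cc | refl =
    ⊥-elim (¬cc (subst (IsCupCap D) (just-injective last) cc))
  wire-prefix ((a , b) ∷ t ∷ W) ((a , b) ∷ t′ ∷ P) (s ∷ steps , j ∷ goods) (_ ∷ steps′ , j′ ∷ goods′) refl (cc ∷ ccs) last ¬cc | refl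
    with cupcap-other-port (Step-target-valid s) (Step-source-valid (All.head steps)) (Step-source-valid (All.head steps′)) cc j j′
  ... | t≡t′ with wire-prefix (t ∷ W) (t′ ∷ P) (steps , goods) (steps′ , goods′) (cong just t≡t′) ccs last ¬cc
  ... | T , P≡ = T , cong ((a , b) ∷_) P≡

  sign-cases : ∀ {τ τ′} → IsSign τ → IsSign τ′ → τ ≡ τ′ ⊎ (τ ≢ 0ℤ × τ ≡ - τ′)
  sign-cases (inj₁ refl) (inj₁ refl) = inj₁ refl
  sign-cases (inj₁ refl) (inj₂ refl) = inj₂ ((λ ()) , refl)
  sign-cases (inj₂ refl) (inj₁ refl) = inj₂ ((λ ()) , refl)
  sign-cases (inj₂ refl) (inj₂ refl) = inj₁ refl

  ConstantTurns : List (Port × Port) → Set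
  ConstantTurns ps = ∃[ τ ] IsSign τ × All (λ j → turnAt D j ≡ τ) (junctions ps)

  -- along a wire cups and caps alternate, so two consecutive opposite turns form a zigzag
  eliminable-or-constant : ∀ s t r → Walk (s ∷ t ∷ r) → All (IsCupCap D) (interior (s ∷ t ∷ r)) →
                           HasEliminablePair D (s ∷ t ∷ r) ⊎ ConstantTurns (s ∷ t ∷ r)
  eliminable-or-constant s t [] walk (cc ∷ []) = inj₂ (_ , cupcap-turn-sign (All.head (Walk-junctions walk)) cc , refl ∷ [])
  eliminable-or-constant s t (e ∷ r) walk@(_ ∷ steps , j ∷ goods) (cc ∷ ccs)
    with eliminable-or-constant t e r (steps , goods) ccs
  ... | inj₁ pair = inj₁ (there pair)
  ... | inj₂ (τ , sign′ , constant) with sign-cases (cupcap-turn-sign (All.head (Walk-junctions walk)) cc) sign′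
  ...   | inj₁ same = inj₂ (τ , sign′ , same ∷ constant)
  ...   | inj₂ (≢0 , opposite) = inj₁ (here (kinds , ≢0 , trans opposite (cong -_ (sym (All.head constant)))))
    where
    kinds : CupCapPair (vtx (proj₂ s)) (vtx (proj₂ t))
    kinds = subst (λ v → CupCapPair v (vtx (proj₂ t))) (sym (proj₁ j))
              (cupcap-alternate (All.head steps) (subst (IsCupCap D) (proj₁ j) cc) (All.head ccs))

  constant-twist≢0 : ∀ s t r → ConstantTurns (s ∷ t ∷ r) → twist D (s ∷ t ∷ r) ≢ 0ℤ
  constant-twist≢0 s t r (_ , sign , constant) = sumTurns-sign≢0 (turnAt D) _ (junctions (t ∷ r)) sign constant

  node∈vertices : ∀ {c} → c < length gs → node c ∈ vertices D
  node∈vertices c< = ∈-++⁺ʳ (map inp (upTo n)) (∈-++⁺ʳ (map outp (upTo k)) (∈-map⁺ node (∈-upTo⁺ c<)))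

  outp∈vertices : ∀ {j} → j < k → outp j ∈ vertices D
  outp∈vertices j< = ∈-++⁺ʳ (map inp (upTo n)) (∈-++⁺ˡ (∈-map⁺ outp (∈-upTo⁺ j<)))

  mu∈vertices : ∀ {c} → IsMU D (node c) → node c ∈ vertices D
  mu∈vertices {c} (inj₁ kind) = node∈vertices (kindAt-< gs c kind)
  mu∈vertices {c} (inj₂ kind) = node∈vertices (kindAt-< gs c kind)

  mu-untwisted : Untwisted D → ∀ {c j S} → IsMU D (node c) → j < k → ShortestPath D (node c) (outp j) S → twist D S ≡ 0ℤ
  mu-untwisted untwisted (inj₁ kind) j<k shortest = untwisted _ m kind (inj₁ refl) _ j<k _ shortest
  mu-untwisted untwisted (inj₂ kind) j<k shortest = untwisted _ u kind (inj₂ (inj₁ refl)) _ j<k _ shortest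

  IsMU-node : ∀ {x} → IsMU D x → ∃[ c ] x ≡ node c
  IsMU-node {node c} _ = c , refl
  IsMU-node {inp _}  (inj₁ ())
  IsMU-node {inp _}  (inj₂ ())
  IsMU-node {outp _} (inj₁ ())
  IsMU-node {outp _} (inj₂ ())

  mu-upper-port : ∀ {x p} → ValidPort gs p → vtx p ≡ x → IsMU D x → side p ≡ hi → p ≡ port x hi 0
  mu-upper-port valid refl (inj₁ kind) _ with leg-of valid kind
  ... | m-out = refl
  mu-upper-port valid refl (inj₂ kind) _ with leg-of valid kind
  ... | u-out = refl

  mu≢outp : ∀ {x j} → IsMU D x → x ≢ outp j
  mu≢outp (inj₁ ()) refl
  mu≢outp (inj₂ ()) refl

  module _ (acyclic : Acyclic D) where

    UniqueBelow : ℕ → Set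
    UniqueBelow n = ∀ {x y} P Q → length P < n → IsPath D x y P → IsPath D x y Q → P ≡ Q

    private
      no-closed-walk : ∀ {w ps} → ¬ IsPath D w w ps
      no-closed-walk = acyclic⇒no-closed-walk acyclic

    same-start-paths-equal : ∀ {x y} P Q → UniqueBelow (length P) → IsPath D x y P → IsPath D x y Q →
                             firstPort P ≡ firstPort Q → P ≡ Q
    same-start-paths-equal ((a , b) ∷ P) ((a , b′) ∷ Q) smaller pathP pathQ refl
      with Step-functional (All.head (proj₁ pathP)) (All.head (proj₁ pathQ))
    same-start-paths-equal ((a , b) ∷ []) ((a , b) ∷ []) _ _ _ refl | refl = refl
    same-start-paths-equal ((a , b) ∷ []) ((a , b) ∷ t ∷ Q) _ (_ , _ , _ , lastP) pathQ refl | refl =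
      ⊥-elim (no-closed-walk (subst (λ z → IsPath D z _ (t ∷ Q)) (just-injective lastP) (path-tail pathQ)))
    same-start-paths-equal ((a , b) ∷ t ∷ P) ((a , b) ∷ []) _ pathP (_ , _ , _ , lastQ) refl | refl =
      ⊥-elim (no-closed-walk (subst (λ z → IsPath D z _ (t ∷ P)) (just-injective lastQ) (path-tail pathP)))
    same-start-paths-equal ((a , b) ∷ t ∷ P) ((a , b) ∷ t′ ∷ Q) smaller pathP pathQ refl | refl =
      cong ((a , b) ∷_) (smaller (t ∷ P) (t′ ∷ Q) ≤-refl (path-tail pathP) (path-tail pathQ))

    paths-equal : ∀ {x y} P Q → UniqueBelow (length P) → IsPath D x y P → IsPath D x y Q → P ≡ Q
    paths-equal []      _        _       (_ , _ , () , _) _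
    paths-equal (s ∷ P) []       _       _                (_ , _ , () , _)
    paths-equal (s ∷ P) (s′ ∷ Q) smaller pathP            pathQ
      with proj₁ s ≟ᵖ proj₁ s′
    ... | yes refl = same-start-paths-equal (s ∷ P) (s′ ∷ Q) smaller pathP pathQ refl
    ... | no _ with lastPort-nonempty s P | lastPort-nonempty s′ Q
    ... | b , eb | b′ , eb′ with b ≟ᵖ b′
    ... | no b≢b′ = ⊥-elim (no-closed-walk (path-++-reverse pathP pathQ eb eb′ b≢b′))
    ... | yes refl = begin
      s ∷ P                                   ≡⟨ reverseWalk-involutive (s ∷ P) ⟨
      reverseWalk (reverseWalk (s ∷ P))       ≡⟨ cong reverseWalk reversed-equal ⟩
      reverseWalk (reverseWalk (s′ ∷ Q))      ≡⟨ reverseWalk-involutive (s′ ∷ Q) ⟩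
      s′ ∷ Q                                  ∎
      where
      open ≡-Reasoning
      reversed-equal : reverseWalk (s ∷ P) ≡ reverseWalk (s′ ∷ Q)
      reversed-equal =
        same-start-paths-equal (reverseWalk (s ∷ P)) (reverseWalk (s′ ∷ Q))
          (subst UniqueBelow (sym (length-reverseWalk (s ∷ P))) smaller) (path-reverse pathP) (path-reverse pathQ)
          (trans (firstPort-reverseWalk (s ∷ P)) (trans eb (trans (sym eb′) (sym (firstPort-reverseWalk (s′ ∷ Q))))))

    unique-below : ∀ n → UniqueBelow n
    unique-below (suc n) P Q (s≤s |P|≤n) =
      paths-equal P Q (λ P′ Q′ |P′|<|P| → unique-below n P′ Q′ (<-≤-trans |P′|<|P| |P|≤n))

    paths-unique : ∀ {x y P Q} → IsPath D x y P → IsPath D x y Q → P ≡ Q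
    paths-unique {P = P} {Q} = unique-below (suc (length P)) P Q ≤-refl

    record UpwardExit (j : ℕ) (x : Vtx) (S : List (Port × Port)) : Set where
      field
        path      : IsPath D x (outp j) S
        untwisted : twist D S ≡ 0ℤ
        leaves-up : firstPort S ≡ just (port x hi 0)

    open UpwardExit

    exit-first-valid : ∀ {j x S} → UpwardExit j x S → ValidPort gs (port x hi 0)
    exit-first-valid {S = s ∷ _} exit with path exit | leaves-up exit
    ... | step ∷ _ , _ | refl = Step-source-valid step

    -- entering w from below and leaving upward does not turn, so W followed by the exit from w
    -- would be a second, twisted path from v to the output
    lower-end-absurd : ∀ {v w W q j Sv Sw} → IsPath D v w W → twist D W ≢ 0ℤ → lastPort W ≡ just q → side q ≡ lo →
                       UpwardExit j v Sv → UpwardExit j w Sw → ⊥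
    lower-end-absurd {v} {w} {W} {q} {j} {Sv} {Sw} pathW@(stepsW , _ , firstW , lastW) twisted eq lower exitv exitw =
      twisted (begin
        twist D W                                         ≡⟨ ℤₚ.+-identityʳ _ ⟨
        twist D W +ℤ 0ℤ                                   ≡⟨ cong (twist D W +ℤ_) (cong₂ _+ℤ_ no-turn (untwisted exitw)) ⟨
        twist D W +ℤ (turnAt D (q , hw) +ℤ twist D Sw)    ≡⟨ twist-++ W Sw eq (leaves-up exitw) ⟨
        twist D (W ++ Sw)                                 ≡⟨ cong (twist D) (paths-unique through-w (path exitv)) ⟩
        twist D Sv                                              ≡⟨ untwisted exitv ⟩
        0ℤ                                                      ∎)
      where
      open ≡-Reasoning
      hw = port w hi 0
      junction : GoodJunction (q , hw)
      junction = just-injective (trans (cong mvtx (sym eq)) lastW) , λ q≡hw → hi≢lo (trans (sym (cong side q≡hw)) lower)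
      no-turn : turnAt D (q , hw) ≡ 0ℤ
      no-turn with junction-turning (lastPort-valid stepsW eq) (exit-first-valid exitw) junction
      ... | inj₁ (same , _) = ⊥-elim (hi≢lo (trans (sym same) lower))
      ... | inj₂ (_ , straight) = straight
      through-w : IsPath D v (outp j) (W ++ Sw)
      through-w = path-++ pathW junction (path exitw) eq (leaves-up exitw)

    -- a wire leaving v upward is the beginning of the exit from v, which then has to leave w by
    -- the wire's last port instead of going up
    upper-ends-absurd : ∀ {v w W j Sv Sw} → IsPath D v w W → All (IsCupCap D) (interior W) → w ≢ outp j →
                        firstPort W ≡ just (port v hi 0) → lastPort W ≡ just (port w hi 0) →
                        UpwardExit j v Sv → UpwardExit j w Sw → ⊥
    upper-ends-absurd {v} {w} {W} {j} {Sv} {Sw} pathW ccs w≢out firstW lastW exitv exitw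
      with wire-prefix W Sv (path-walk pathW) (path-walk (path exitv)) (trans firstW (sym (leaves-up exitv))) ccs
                       (proj₂ (proj₂ (proj₂ (path exitv)))) (λ { (inj₁ ()) ; (inj₂ ()) })
    ... | T , refl with T | path exitv
    ... | [] | (_ , _ , _ , lastv) =
      w≢out (just-injective (trans (sym (proj₂ (proj₂ (proj₂ pathW)))) (trans (cong (mvtx ∘ lastPort) (sym (++-identityʳ W))) lastv)))
    ... | t ∷ T′ | pathv@(_ , _ , _ , lastv) with Walk-++⁻ W (t ∷ T′) lastW refl (path-walk pathv)
    ... | _ , (vtx≡ , hw≢t) , (steps , goods) =
      hw≢t (sym (just-injective (trans (cong firstPort (paths-unique exit-from-w (path exitw))) (leaves-up exitw))))
      where
      last-T = lastPort-nonempty t T′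
      exit-from-w : IsPath D w (outp j) (t ∷ T′)
      exit-from-w = steps , goods , cong just (sym vtx≡) ,
                    trans (cong mvtx (proj₂ last-T)) (trans (cong mvtx (sym (lastPort-++ W (t ∷ T′) (proj₂ last-T)))) lastv)

    twisted-wire-absurd : ∀ {v w W j Sv Sw} → IsWire D v w W → twist D W ≢ 0ℤ → UpwardExit j v Sv → UpwardExit j w Sw → ⊥
    twisted-wire-absurd {v} {w} {s ∷ r} (pathW@(steps , _ , firstW , lastW) , muv , muw , ccs) twisted exitv exitw
      with lastPort-nonempty s r
    ... | q , eq with side q in side-q
    ... | lo = lower-end-absurd pathW twisted eq side-q exitv exitw
    ... | hi with side (proj₁ s) in side-p
    ... | lo = lower-end-absurd (path-reverse pathW) (twisted ∘ negated) (lastPort-reverseWalk s r) side-p exitw exitv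
      where
      negated : twist D (reverseWalk (s ∷ r)) ≡ 0ℤ → twist D (s ∷ r) ≡ 0ℤ
      negated rev≡0 = trans (sym (ℤₚ.neg-involutive _)) (cong -_ (trans (sym (twist-reverseWalk (path-walk pathW))) rev≡0))
    ... | hi = upper-ends-absurd pathW ccs (mu≢outp muw)
                 (cong just (mu-upper-port (Step-source-valid (All.head steps)) (just-injective firstW) muv side-p))
                 (trans eq (cong just (mu-upper-port (lastPort-valid steps eq) (just-injective (trans (cong mvtx (sym eq)) lastW)) muw side-q)))
                 exitv exitw

    -- by uniqueness of paths, the path to the output is the shortest one, so it is untwisted,
    -- and by parity it leaves upward
    upward-exit : Connected D → Untwisted D → ∀ {x j} → j < k → IsMU D x → ∃ (UpwardExit j x)
    upward-exit connected untwisted {x} {j} j<k mu with IsMU-node {x} mu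
    ... | c , refl with connected (node c) (outp j) (mu∈vertices mu) (outp∈vertices j<k)
    ... | inj₂ (s ∷ r , pathS@(steps , _ , firstS , _)) =
      s ∷ r , record { path = pathS ; untwisted = untwisted-S ; leaves-up = cong just upper-start }
      where
      shortest : ShortestPath D (node c) (outp j) (s ∷ r)
      shortest = pathS , λ qs pathQ → ≤-reflexive (cong length (paths-unique pathS pathQ))
      untwisted-S : twist D (s ∷ r) ≡ 0ℤ
      untwisted-S = mu-untwisted untwisted mu j<k shortest
      upper-start : proj₁ s ≡ port (node c) hi 0
      upper-start = mu-upper-port (Step-source-valid (All.head steps)) (just-injective firstS) mu (departs-upward pathS untwisted-S)

open Graph

mainTheorem10 : ∀ {n k : ℕ} (D : Diagram n k) → Simple D → Untwisted D →
  ∀ (v w : Vtx) (ps : List (Port × Port)) → IsWire D v w ps →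
  Straight D ps ⊎ HasEliminablePair D ps
mainTheorem10 D _ _ v w []          _ = inj₁ []
mainTheorem10 D _ _ v w (_ ∷ [])    _ = inj₁ []
mainTheorem10 D (connected , acyclic , refl) untwisted v w (s ∷ t ∷ r) wire@(path , muv , muw , ccs)
  with eliminable-or-constant D s t r (path-walk D path) ccs
... | inj₁ zigzag   = inj₂ zigzag
... | inj₂ constant =
  ⊥-elim (twisted-wire-absurd D acyclic wire (constant-twist≢0 D s t r constant)
            (proj₂ (upward-exit D acyclic connected untwisted (s≤s z≤n) muv))
            (proj₂ (upward-exit D acyclic connected untwisted (s≤s z≤n) muw)))
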